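{- Let $L'(x,y)=(-x+2y+1,\,y)$ and $L''(x,y)=(x,\,2x-y+1)$ on $\mathbb{Z}^2$. For an integer $n\ge0$ let $L^{[n]}$ denote the composition of $n$ operators $L'$ and $L''$ applied alternately, starting with $L'$: $L^{[0]}=\mathrm{Id}$, $L^{[1]}=L'$, $L^{[2]}=L''\circ L'$, $L^{[3]}=L'\circ L''\circ L'$, and so on. Then for all integers $a,b$ and $n\ge0$, $$L^{[n]}(a,0)=\Big(\big(-2\lfloor\tfrac{n+1}{2}\rfloor+1\big)a+T_{2\lfloor\frac{n+1}{2}\rfloor-1},\ -2\lfloor\tfrac n2\rfloor a+T_{2\lfloor\frac n2\rfloor}\Big),$$ $$L^{[n]}(0,b)=\Big(2\lfloor\tfrac{n+1}{2}\rfloor b+T_{2\lfloor\frac{n+1}{2}\rfloor-1},\ \big(2\lfloor\tfrac n2\rfloor+1\big)b+T_{2\lfloor\frac n2\rfloor}\Big),$$ where $T_j=j(j+1)/2$ (so $T_{ -1}=0$). -}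

module Defs where

open import Data.Nat as ℕ using (ℕ; zero; suc)
open import Data.Integer using (ℤ; +_; _+_; _-_; _*_; -_; _/_)
open import Data.Product using (_×_; _,_)

L′ : ℤ × ℤ → ℤ × ℤ
L′ (x , y) = (- x + + 2 * y + + 1 , y)

L″ : ℤ × ℤ → ℤ × ℤ
L″ (x , y) = (x , + 2 * x - y + + 1)

mutual
  Lstep′ : ℕ → ℤ × ℤ → ℤ × ℤ
  Lstep′ zero    p = p
  Lstep′ (suc n) p = Lstep″ n (L′ p)

  Lstep″ : ℕ → ℤ × ℤ → ℤ × ℤ
  Lstep″ zero    p = p
  Lstep″ (suc n) p = Lstep′ n (L″ p)

L[_] : ℕ → ℤ × ℤ → ℤ × ℤ
L[ n ] = Lstep′ n

-- Triangular numbers T_j = j(j+1)/2 for integer j (exact division; T_{-1} = 0)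
T : ℤ → ℤ
T j = (j * (j + + 1)) / + 2

-- Both L′ and L″ are affine, so the closed form holds for an arbitrary starting point (a , b):
-- the coordinates of L^[n](a , b) are affine in (a , b) with coefficients polynomial in
-- m′ = ⌊(n+1)/2⌋ and m = ⌊n/2⌋.  This general form is what makes the induction work, because
-- L^[n+2] = L^[n] ∘ (L″ ∘ L′) and L″ ∘ L′ moves points off the axes; one step of L″ ∘ L′
-- on the starting point raises m′ and m by one, a polynomial identity.  Triangular numbers
-- enter only at the end, through T(2m) = m(2m+1) and T(2m−1) = m(2m−1).
module Submission where

open import Defs
open import Data.Nat as ℕ using (ℕ; zero; suc; s≤s; z≤n)
open import Data.Nat.DivMod using (m*n/n≡m; m*n%n≡0; m/n≡1+[m∸n]/n)
open import Data.Integer using (ℤ; +_; -[1+_]; _+_; _-_; _*_; -_; _/ℕ_)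
open import Data.Integer.Properties using (*-identityˡ; pos-*)
open import Data.Integer.Tactic.RingSolver using (solve)
open import Data.List using (_∷_; [])
open import Data.Product using (_×_; _,_)
open import Relation.Binary.PropositionalEquality using (_≡_; sym; trans; cong; cong₂; module ≡-Reasoning)

[2+n]/2≡1+n/2 : ∀ n → suc (suc n) ℕ./ 2 ≡ suc (n ℕ./ 2)
[2+n]/2≡1+n/2 n = m/n≡1+[m∸n]/n {suc (suc n)} (s≤s (s≤s z≤n))

i*2/ℕ2≡i : ∀ i → (i * + 2) /ℕ 2 ≡ i
i*2/ℕ2≡i (+ k) rewrite sym (pos-* k 2) = cong +_ (m*n/n≡m k 2)
i*2/ℕ2≡i -[1+ k ] rewrite m*n%n≡0 (suc k) 2 ⦃ _ ⦄ = cong (λ q → - (+ q)) (m*n/n≡m (suc k) 2)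

j*[j+1]≡t*2⇒T[j]≡t : ∀ j t → j * (j + + 1) ≡ t * + 2 → T j ≡ t
j*[j+1]≡t*2⇒T[j]≡t j t eq = begin
  T j                    ≡⟨ *-identityˡ _ ⟩
  (j * (j + + 1)) /ℕ 2  ≡⟨ cong (_/ℕ 2) eq ⟩
  (t * + 2) /ℕ 2        ≡⟨ i*2/ℕ2≡i t ⟩
  t                      ∎
  where open ≡-Reasoning

T[2m]≡m*[2m+1] : ∀ m → T (+ 2 * m) ≡ m * (+ 2 * m + + 1)
T[2m]≡m*[2m+1] m = j*[j+1]≡t*2⇒T[j]≡t (+ 2 * m) (m * (+ 2 * m + + 1)) (solve (m ∷ []))

T[2m-1]≡m*[2m-1] : ∀ m → T (+ 2 * m - + 1) ≡ m * (+ 2 * m - + 1)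
T[2m-1]≡m*[2m-1] m = j*[j+1]≡t*2⇒T[j]≡t (+ 2 * m - + 1) (m * (+ 2 * m - + 1)) (solve (m ∷ []))

orbit : ℤ → ℤ → ℤ → ℤ → ℤ × ℤ
orbit m′ m a b =
  ( (- (+ 2 * m′) + + 1) * a + + 2 * m′ * b + m′ * (+ 2 * m′ - + 1)
  , - (+ 2 * m) * a + (+ 2 * m + + 1) * b + m * (+ 2 * m + + 1))

-- The arguments on the left are the coordinates of L″ (L′ (a , b)).
orbit-shift : ∀ m′ m a b →
  orbit m′ m (- a + + 2 * b + + 1) (+ 2 * (- a + + 2 * b + + 1) - b + + 1)
    ≡ orbit (+ 1 + m′) (+ 1 + m) a b
orbit-shift m′ m a b = cong₂ _,_ (solve (m′ ∷ a ∷ b ∷ [])) (solve (m ∷ a ∷ b ∷ []))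

L[n]≡orbit : ∀ n a b → L[ n ] (a , b) ≡ orbit (+ ((n ℕ.+ 1) ℕ./ 2)) (+ (n ℕ./ 2)) a b
L[n]≡orbit zero          a b = cong₂ _,_ (solve (a ∷ b ∷ [])) (solve (a ∷ b ∷ []))
L[n]≡orbit (suc zero)    a b = cong₂ _,_ (solve (a ∷ b ∷ [])) (solve (a ∷ b ∷ []))
L[n]≡orbit (suc (suc n)) a b = begin
  L[ n ] (a′ , b′)                    ≡⟨ L[n]≡orbit n a′ b′ ⟩
  orbit m′ m a′ b′                    ≡⟨ orbit-shift m′ m a b ⟩
  orbit (+ 1 + m′) (+ 1 + m) a b      ≡⟨ cong₂ (λ k′ k → orbit (+ k′) (+ k) a b)
                                                (sym ([2+n]/2≡1+n/2 (n ℕ.+ 1))) (sym ([2+n]/2≡1+n/2 n)) ⟩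
  orbit (+ ((suc (suc n) ℕ.+ 1) ℕ./ 2)) (+ (suc (suc n) ℕ./ 2)) a b ∎
  where
  open ≡-Reasoning
  a′ b′ m′ m : ℤ
  a′ = - a + + 2 * b + + 1
  b′ = + 2 * a′ - b + + 1
  m′ = + ((n ℕ.+ 1) ℕ./ 2)
  m  = + (n ℕ./ 2)

orbit-via-T : ∀ m′ m a b → orbit m′ m a b ≡
  ( (- (+ 2 * m′) + + 1) * a + + 2 * m′ * b + T (+ 2 * m′ - + 1)
  , - (+ 2 * m) * a + (+ 2 * m + + 1) * b + T (+ 2 * m))
orbit-via-T m′ m a b =
  cong₂ (λ s t → ((- (+ 2 * m′) + + 1) * a + + 2 * m′ * b + s , - (+ 2 * m) * a + (+ 2 * m + + 1) * b + t))
    (sym (T[2m-1]≡m*[2m-1] m′)) (sym (T[2m]≡m*[2m+1] m))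

orbit-on-x-axis : ∀ m′ m a → orbit m′ m a (+ 0) ≡
  ((- (+ 2 * m′) + + 1) * a + T (+ 2 * m′ - + 1) , - (+ 2 * m) * a + T (+ 2 * m))
orbit-on-x-axis m′ m a =
  trans (orbit-via-T m′ m a (+ 0)) (cong₂ _,_ (solve (m′ ∷ a ∷ [])) (solve (m ∷ a ∷ [])))

orbit-on-y-axis : ∀ m′ m b → orbit m′ m (+ 0) b ≡
  (+ 2 * m′ * b + T (+ 2 * m′ - + 1) , (+ 2 * m + + 1) * b + T (+ 2 * m))
orbit-on-y-axis m′ m b =
  trans (orbit-via-T m′ m (+ 0) b) (cong₂ _,_ (solve (m′ ∷ b ∷ [])) (solve (m ∷ b ∷ [])))

lemma2p2 : (a b : ℤ) (n : ℕ) →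
    (L[ n ] (a , + 0) ≡
      ((- (+ 2 * + ((n ℕ.+ 1) ℕ./ 2)) + + 1) * a + T (+ 2 * + ((n ℕ.+ 1) ℕ./ 2) - + 1)
      , - (+ 2 * + (n ℕ./ 2)) * a + T (+ 2 * + (n ℕ./ 2))))
    × (L[ n ] (+ 0 , b) ≡
      (+ 2 * + ((n ℕ.+ 1) ℕ./ 2) * b + T (+ 2 * + ((n ℕ.+ 1) ℕ./ 2) - + 1)
      , (+ 2 * + (n ℕ./ 2) + + 1) * b + T (+ 2 * + (n ℕ./ 2))))
lemma2p2 a b n =
  trans (L[n]≡orbit n a (+ 0)) (orbit-on-x-axis m′ m a) ,
  trans (L[n]≡orbit n (+ 0) b) (orbit-on-y-axis m′ m b)
  where
  m′ m : ℤ
  m′ = + ((n ℕ.+ 1) ℕ./ 2)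
  m  = + (n ℕ./ 2)
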